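{- For all integers $n\ge1$ and $1\le k\le n$, \[ \sum_{i=0}^{n-1}p(i)\,\widehat u_{n-i,k}(f,w)=D_f\!\left(\frac nk\right)[n\equiv0 \bmod k]+\frac{1}{\widehat f(1)}[n=k], \] where the first term on the right is interpreted as $0$ when $k\nmid n$.
   Context: Fix $w\in\mathbb{C}$, $w\ne0$, not a root of unity, and an arithmetic function $f$ with $f(1)\ne0$. $p(m)$ is the partition function ($p(0)=1$, $p(m)=0$ for $m<0$); $[P]$ is the Iverson bracket. Put $\widehat f(n):=\frac{w^n}{w^n-1}f(n)$. Let $u_{n,k}(f,w)$ be the entries of the inverse of the lower triangular matrix with entries $\sum_{m=1}^{n}\big(\sum_{d\mid\gcd(m,n)}f(d)p(n/d-k)\big)w^m$ for $1\le k\le n$ (and $0$ for $k>n$), and set $\widehat u_{n,k}(f,w):=(w^k-1)u_{n,k}(f,w)$, which is $0$ for $k>n$. Define $\mathrm{ds}_1(f;n):=(-1)^{\delta_{n,1}}\widehat f(n)$, $\mathrm{ds}_j(f;n):=\sum_{d\mid n,\ d>1}\widehat f(d)\,\mathrm{ds}_{j-1}(f;n/d)$ for $j\ge2$, and $D_f(n):=\sum_{j=1}^{n}\mathrm{ds}_{2j}(f;n)/\widehat f(1)^{2j+1}$. -}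

module Defs where

open import Level using (Level; _⊔_) renaming (suc to lsuc)
open import Data.Nat as ℕ using (ℕ; zero; suc; _∸_; _≤ᵇ_; _≡ᵇ_)
open import Data.Nat.Divisibility using (_∣?_)
open import Data.Nat.DivMod using (_/_)
open import Data.Nat.GCD using (gcd)
open import Data.Bool using (Bool; true; false; if_then_else_)
open import Relation.Nullary using (¬_; does)
open import Algebra.Bundles using (CommutativeRing)

-- Fields (agda-stdlib has no Field bundle): a commutative ring with
-- 0 ≠ 1 and a (total) inverse operation that is a multiplicative
-- inverse on every nonzero element (its value at 0 is irrelevant).

record Field (c ℓ : Level) : Set (lsuc (c ⊔ ℓ)) where
  field
    commutativeRing : CommutativeRing c ℓ
  open CommutativeRing commutativeRing public
  field
    _⁻¹      : Carrier → Carrier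
    ⁻¹-cong  : ∀ {x y} → x ≈ y → x ⁻¹ ≈ y ⁻¹
    ⁻¹-inverse : ∀ x → ¬ (x ≈ 0#) → x * (x ⁻¹) ≈ 1#
    0≉1      : ¬ (0# ≈ 1#)

-- Partition function (ℕ-valued).
-- parts m k = number of partitions of m into parts of size ≤ k:
-- for parts ≤ k+1, choose the multiplicity j of the part k+1
-- (0 ≤ j ≤ m/(k+1)) and partition the rest into parts ≤ k.

sumℕ : ℕ → (ℕ → ℕ) → ℕ
sumℕ zero    g = 0
sumℕ (suc n) g = sumℕ n g ℕ.+ g n

parts : ℕ → ℕ → ℕ
parts m zero    = if m ≡ᵇ 0 then 1 else 0
parts m (suc k) = sumℕ (suc (m / suc k)) (λ j → parts (m ∸ j ℕ.* suc k) k)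

p : ℕ → ℕ
p m = parts m m

-- pSub a b = p(a - b) with the convention p(negative) = 0
pSub : ℕ → ℕ → ℕ
pSub a b = if b ≤ᵇ a then p (a ∸ b) else 0

-- integer division, with the (unused) convention n div 0 = 0
_div_ : ℕ → ℕ → ℕ
n div zero  = 0
n div suc d = n / suc d

module _ {c ℓ : Level} (F : Field c ℓ) where
  open Field F

  ι : ℕ → Carrier
  ι zero    = 0#
  ι (suc n) = 1# + ι n

  pow : Carrier → ℕ → Carrier
  pow x zero    = 1#
  pow x (suc n) = x * pow x n

  Σ< : ℕ → (ℕ → Carrier) → Carrier
  Σ< zero    g = 0#
  Σ< (suc n) g = Σ< n g + g n

  Σ1 : ℕ → (ℕ → Carrier) → Carrier
  Σ1 n g = Σ< n (λ i → g (suc i))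

  [_]⇒_ : Bool → Carrier → Carrier
  [ b ]⇒ x = if b then x else 0#

  -- Σ_{d ∣ n} g d  (for n ≥ 1; divisors lie in 1..n)
  Σdiv : ℕ → (ℕ → Carrier) → Carrier
  Σdiv n g = Σ1 n (λ d → [ does (d ∣? n) ]⇒ g d)

  Σdiv>1 : ℕ → (ℕ → Carrier) → Carrier
  Σdiv>1 n g = Σ1 n (λ d → [ does (d ∣? n) Data.Bool.∧ (2 ≤ᵇ d) ]⇒ g d)

  module _ (f : ℕ → Carrier) (w : Carrier) where

    fhat : ℕ → Carrier
    fhat n = (pow w n * (pow w n - 1#) ⁻¹) * f n

    -- the lower triangular matrix whose inverse is u_{n,k}(f,w)
    A : ℕ → ℕ → Carrier
    A n k = if k ≤ᵇ n
            then Σ1 n (λ m → Σdiv (gcd m n) (λ d → f d * ι (pSub (n div d) k)) * pow w m)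
            else 0#

    -- ds j n = ds_{j+1}(f; n)
    ds : ℕ → ℕ → Carrier
    ds zero    n = if n ≡ᵇ 1 then - fhat n else fhat n
    ds (suc j) n = Σdiv>1 n (λ d → fhat d * ds j (n div d))

    D : ℕ → Carrier
    D n = Σ1 n (λ j → ds (2 ℕ.* j ∸ 1) n * (pow (fhat 1) (2 ℕ.* j ℕ.+ 1)) ⁻¹)

    module _ (u : ℕ → ℕ → Carrier) where
      uhat : ℕ → ℕ → Carrier
      uhat n k = (pow w k - 1#) * u n k

  CharZero : Set ℓ
  CharZero = ∀ m → ¬ (ι (suc m) ≈ 0#)

module Submission where

-- Write f̂ = fhat f w and (g ⋆ Z)(n) = Σ_{d ∣ n} g(d) Z(n/d) for Dirichlet convolution.  Both
-- sides of the identity, as functions of n ≥ 1, have convolution δ_k with f̂; since f̂(1) ≠ 0,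
-- convolution with f̂ is injective (⋆-injective), so they agree.
--  * Left side.  By interchanging the sums over m and over d ∣ gcd(m,n) and summing geometric
--    series over the multiples of d (w is not a root of unity), the matrix factors as
--    A(n,j) = (wⁿ − 1) Σ_{d ∣ n} f̂(d) p(n/d − j).  So Σ_j A(n,j) u(j,k) = δ_k(n) turns into
--    f̂ ⋆ X = δ_k for X(e) = Σ_{i<e} p(i) û_{e−i,k}  (Matrix, Column).
--  * Right side.  G = D_f + [· = 1]/f̂(1) is the Dirichlet inverse of f̂: D_f is an alternating
--    sum of the convolution powers of f̂ over divisors > 1, and f̂ ⋆ G telescopes to δ_1
--    (Inverse).  The right side is the dilation G_k(qk) = G(q) of G, and convolution commutes
--    with dilation (⋆-dilate), so f̂ ⋆ G_k = δ_k.

open import Defs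
open import Level using (Level)
open import Data.Nat as ℕ using (ℕ; zero; suc; _∸_; _≤_; _<_; _≡ᵇ_; _≤ᵇ_; z≤n; s≤s)
open import Data.Nat.Properties as ℕP using (_≟_; _≤?_)
open import Data.Nat.Divisibility
  using (_∣_; _∣?_; divides-refl; 1∣_; ∣-refl; ∣-trans; ∣⇒≤; n∣m*n; m∣m*n; ∣m+n∣m⇒∣n; m/n∣m; m∣n/o⇒o*m∣n; *-cancelʳ-∣)
open import Data.Nat.DivMod using (_/_; n/n≡1; m/n*n≡m; m*n/n≡m; n/1≡n; m/n<m; m/n≤m; m≥n⇒m/n>0; *-/-assoc)
open import Data.Nat.GCD using (gcd; gcd-greatest; gcd[m,n]∣m; gcd[m,n]∣n; gcd[m,n]≢0)
open import Data.Nat.Induction using (<-rec)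
open import Data.Bool using (Bool; true; false; _∧_; if_then_else_)
open import Data.Bool.Properties using (∧-zeroʳ; ∧-identityʳ)
open import Data.Product using (_×_; _,_)
import Data.Sum as ⊎
import Algebra.Properties.CommutativeSemigroup
open import Data.Empty using (⊥-elim)
open import Relation.Nullary using (¬_; Dec; does; yes; no)
open import Relation.Nullary.Decidable using (dec-true; dec-false)
open import Relation.Binary.PropositionalEquality as ≡ using (_≡_; _≢_)

≡ᵇ-true : ∀ {m n} → m ≡ n → (m ≡ᵇ n) ≡ true
≡ᵇ-true {m} {n} = dec-true (m ≟ n)

≡ᵇ-false : ∀ {m n} → m ≢ n → (m ≡ᵇ n) ≡ false
≡ᵇ-false {m} {n} = dec-false (m ≟ n)

≤ᵇ-true : ∀ {m n} → m ≤ n → (m ≤ᵇ n) ≡ true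
≤ᵇ-true {m} {n} = dec-true (m ≤? n)

≤ᵇ-false : ∀ {m n} → ¬ m ≤ n → (m ≤ᵇ n) ≡ false
≤ᵇ-false {m} {n} = dec-false (m ≤? n)

witness : ∀ {p} {P : Set p} (P? : Dec P) → does P? ≡ true → P
witness (yes p) _  = p
witness (no _)  ()

divisor>1 : ∀ n i → (does (suc i ∣? n) ∧ (2 ≤ᵇ suc i)) ≡ true → suc i ∣ n × 1 ≤ i
divisor>1 n zero    eq with () ← ≡.trans (≡.sym (∧-zeroʳ (does (1 ∣? n)))) eq
divisor>1 n (suc i) eq = witness (suc (suc i) ∣? n) (≡.trans (≡.sym (∧-identityʳ _)) eq) , s≤s z≤n

quotient-pos : ∀ {n} d → suc d ∣ n → 1 ≤ n → 1 ≤ n / suc d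
quotient-pos {suc n} d d∣n _ = m≥n⇒m/n>0 (∣⇒≤ d∣n)

quotient-< : ∀ {n} d → 1 ≤ n → 1 ≤ d → n / suc d < n
quotient-< {suc n} (suc d) _ _ = m/n<m (suc n) (suc (suc d)) (s≤s (s≤s z≤n))

∣gcd≡∧ : ∀ d m n → does (d ∣? gcd m n) ≡ does (d ∣? m) ∧ does (d ∣? n)
∣gcd≡∧ d m n with d ∣? m | d ∣? n
... | yes d∣m | yes d∣n = dec-true (d ∣? gcd m n) (gcd-greatest d∣m d∣n)
... | yes _   | no d∤n  = dec-false (d ∣? gcd m n) (λ d∣g → d∤n (∣-trans d∣g (gcd[m,n]∣n m n)))
... | no d∤m  | _       = dec-false (d ∣? gcd m n) (λ d∣g → d∤m (∣-trans d∣g (gcd[m,n]∣m m n)))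

*-≡ᵇ-cancelʳ : ∀ q k → (q ℕ.* suc k ≡ᵇ suc k) ≡ (q ≡ᵇ 1)
*-≡ᵇ-cancelʳ q k with q ≟ 1
... | yes ≡.refl = ≡ᵇ-true (ℕP.*-identityˡ (suc k))
... | no q≢1     = ≡.trans (≡ᵇ-false qk≢k) (≡.sym (≡ᵇ-false q≢1))
  where
  qk≢k : q ℕ.* suc k ≢ suc k
  qk≢k eq = q≢1 (ℕP.*-cancelʳ-≡ q 1 (suc k) (≡.trans eq (≡.sym (ℕP.*-identityˡ (suc k)))))

*-/-∣ : ∀ m k d → suc d ∣ m → (m ℕ.* k) / suc d ≡ (m / suc d) ℕ.* k
*-/-∣ m k d d∣m = ≡.trans (≡.cong (_/ suc d) (ℕP.*-comm m k))
                    (≡.trans (*-/-assoc k d∣m) (ℕP.*-comm k (m / suc d)))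

module FieldLemmas {c ℓ : Level} (F : Field c ℓ) where
  open Field F
  open import Algebra.Properties.Ring ring using (-‿distribˡ-*; -‿distribʳ-*; -0#≈0#; -‿+-comm)
  open import Algebra.Properties.AbelianGroup +-abelianGroup using (x∙y⁻¹≈ε⇒x≈y; ∙-cancelʳ)
  open import Relation.Binary.Reasoning.Setoid setoid
  open import Algebra.Solver.Ring.NaturalCoefficients.Default commutativeSemiring
    using (solve; _:+_; _:*_; _:=_)
  module +-CS = Algebra.Properties.CommutativeSemigroup +-commutativeSemigroup
  module *-CS = Algebra.Properties.CommutativeSemigroup *-commutativeSemigroup

  ≡⇒≈ : ∀ {x y} → x ≡ y → x ≈ y
  ≡⇒≈ ≡.refl = refl

  sub≈0⇒≈ : ∀ {x y} → x - y ≈ 0# → x ≈ y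
  sub≈0⇒≈ {x} {y} = x∙y⁻¹≈ε⇒x≈y x y

  *-distribˡ-- : ∀ x y z → x * (y - z) ≈ x * y - x * z
  *-distribˡ-- x y z = trans (distribˡ x y (- z)) (+-congˡ (sym (-‿distribʳ-* x z)))

  *-distribʳ-- : ∀ x y z → (y - z) * x ≈ y * x - z * x
  *-distribʳ-- x y z = trans (*-comm _ x) (trans (*-distribˡ-- x y z) (+-cong (*-comm x y) (-‿cong (*-comm x z))))

  sub-+-sub : ∀ x y z → (x - y) + (z - x) ≈ z - y
  sub-+-sub x y z = begin
    (x - y) + (z - x)
      ≈⟨ solve 4 (λ x y′ z x′ → (x :+ y′) :+ (z :+ x′) := (z :+ y′) :+ (x :+ x′)) refl x (- y) z (- x) ⟩
    (z - y) + (x - x)        ≈⟨ +-congˡ (-‿inverseʳ x) ⟩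
    (z - y) + 0#             ≈⟨ +-identityʳ _ ⟩
    z - y                    ∎

  +-sub-cancel : ∀ x y → x + (y - x) ≈ y
  +-sub-cancel x y = begin
    x + (y - x)     ≈⟨ +-comm x _ ⟩
    (y - x) + x     ≈⟨ +-assoc y (- x) x ⟩
    y + (- x + x)   ≈⟨ +-congˡ (-‿inverseˡ x) ⟩
    y + 0#          ≈⟨ +-identityʳ y ⟩
    y               ∎

  *-cancelˡ : ∀ {x y z} → x ≉ 0# → x * y ≈ x * z → y ≈ z
  *-cancelˡ {x} {y} {z} x≉0 eq = begin
    y                 ≈⟨ sym (*-identityˡ y) ⟩
    1# * y            ≈⟨ *-congʳ (sym (trans (*-comm _ _) (⁻¹-inverse x x≉0))) ⟩
    (x ⁻¹ * x) * y    ≈⟨ *-assoc _ _ _ ⟩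
    x ⁻¹ * (x * y)    ≈⟨ *-congˡ eq ⟩
    x ⁻¹ * (x * z)    ≈⟨ sym (*-assoc _ _ _) ⟩
    (x ⁻¹ * x) * z    ≈⟨ *-congʳ (trans (*-comm _ _) (⁻¹-inverse x x≉0)) ⟩
    1# * z            ≈⟨ *-identityˡ z ⟩
    z                 ∎

  *-≉0 : ∀ {x y} → x ≉ 0# → y ≉ 0# → x * y ≉ 0#
  *-≉0 x≉0 y≉0 xy≈0 = y≉0 (*-cancelˡ x≉0 (trans xy≈0 (sym (zeroʳ _))))

  ⁻¹-≉0 : ∀ {x} → x ≉ 0# → x ⁻¹ ≉ 0#
  ⁻¹-≉0 {x} x≉0 x⁻¹≈0 = 0≉1 (begin
    0#         ≈⟨ sym (zeroʳ x) ⟩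
    x * 0#     ≈⟨ *-congˡ (sym x⁻¹≈0) ⟩
    x * x ⁻¹   ≈⟨ ⁻¹-inverse x x≉0 ⟩
    1#         ∎)

  ⁻¹-unique : ∀ {x y} → x * y ≈ 1# → x ⁻¹ ≈ y
  ⁻¹-unique {x} {y} xy≈1 = *-cancelˡ x≉0 (trans (⁻¹-inverse x x≉0) (sym xy≈1))
    where
    x≉0 : x ≉ 0#
    x≉0 x≈0 = 0≉1 (trans (sym (trans (*-congʳ x≈0) (zeroˡ y))) xy≈1)

  infixr 8 _^_
  _^_ : Carrier → ℕ → Carrier
  x ^ n = pow F x n

  ^-+ : ∀ x m n → x ^ (m ℕ.+ n) ≈ x ^ m * x ^ n
  ^-+ x zero    n = sym (*-identityˡ _)
  ^-+ x (suc m) n = trans (*-congˡ (^-+ x m n)) (sym (*-assoc _ _ _))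

  ^-≉0 : ∀ {x} n → x ≉ 0# → x ^ n ≉ 0#
  ^-≉0 zero    x≉0 1≈0 = 0≉1 (sym 1≈0)
  ^-≉0 (suc n) x≉0     = *-≉0 x≉0 (^-≉0 n x≉0)

  ^-⁻¹ : ∀ {x} n → x ≉ 0# → (x ^ n) ⁻¹ ≈ (x ⁻¹) ^ n
  ^-⁻¹ {x} n x≉0 = ⁻¹-unique (product n)
    where
    product : ∀ n → x ^ n * (x ⁻¹) ^ n ≈ 1#
    product zero    = *-identityˡ 1#
    product (suc n) = begin
      (x * x ^ n) * (x ⁻¹ * (x ⁻¹) ^ n)
        ≈⟨ *-CS.interchange x (x ^ n) (x ⁻¹) ((x ⁻¹) ^ n) ⟩
      (x * x ⁻¹) * (x ^ n * (x ⁻¹) ^ n)   ≈⟨ *-cong (⁻¹-inverse x x≉0) (product n) ⟩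
      1# * 1#                              ≈⟨ *-identityˡ 1# ⟩
      1#                                   ∎

  infix 8 [_]·_
  [_]·_ : Bool → Carrier → Carrier
  [ b ]· x = [_]⇒_ F b x

  [·]-congᵗ : ∀ b {x y} → (b ≡ true → x ≈ y) → [ b ]· x ≈ [ b ]· y
  [·]-congᵗ true  eq = eq ≡.refl
  [·]-congᵗ false eq = refl

  [·]-true : ∀ {b} x → b ≡ true → [ b ]· x ≈ x
  [·]-true x ≡.refl = refl

  [·]-false : ∀ {b} x → b ≡ false → [ b ]· x ≈ 0#
  [·]-false x ≡.refl = refl

  [·]-0 : ∀ b → [ b ]· 0# ≈ 0#
  [·]-0 true  = refl
  [·]-0 false = refl

  [·]-*ˡ : ∀ b x y → x * ([ b ]· y) ≈ [ b ]· (x * y)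
  [·]-*ˡ true  x y = refl
  [·]-*ˡ false x y = zeroʳ x

  [·]-∧-* : ∀ a b x y → ([ a ∧ b ]· x) * y ≈ ([ b ]· x) * ([ a ]· y)
  [·]-∧-* true  b     x y = refl
  [·]-∧-* false true  x y = trans (zeroˡ y) (sym (zeroʳ x))
  [·]-∧-* false false x y = trans (zeroˡ y) (sym (zeroˡ 0#))

  [·]-*ʳ : ∀ b x y → ([ b ]· x) * y ≈ [ b ]· (x * y)
  [·]-*ʳ true  x y = refl
  [·]-*ʳ false x y = zeroˡ y

  [·]-+ : ∀ b x y → [ b ]· (x + y) ≈ [ b ]· x + [ b ]· y
  [·]-+ true  x y = refl
  [·]-+ false x y = sym (+-identityʳ 0#)

  [·]-neg : ∀ b x → [ b ]· (- x) ≈ - ([ b ]· x)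
  [·]-neg true  x = refl
  [·]-neg false x = sym -0#≈0#

  Σ-cong : ∀ n {g h : ℕ → Carrier} → (∀ i → i < n → g i ≈ h i) → Σ< F n g ≈ Σ< F n h
  Σ-cong zero    eq = refl
  Σ-cong (suc n) eq = +-cong (Σ-cong n (λ i i<n → eq i (ℕP.m<n⇒m<1+n i<n))) (eq n ℕP.≤-refl)

  Σ-0 : ∀ n {g} → (∀ i → i < n → g i ≈ 0#) → Σ< F n g ≈ 0#
  Σ-0 zero    eq = refl
  Σ-0 (suc n) eq = trans (+-cong (Σ-0 n (λ i i<n → eq i (ℕP.m<n⇒m<1+n i<n))) (eq n ℕP.≤-refl)) (+-identityʳ 0#)

  Σ-+ : ∀ n g h → Σ< F n (λ i → g i + h i) ≈ Σ< F n g + Σ< F n h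
  Σ-+ zero    g h = sym (+-identityʳ 0#)
  Σ-+ (suc n) g h = trans (+-congʳ (Σ-+ n g h)) (+-CS.interchange _ _ _ _)

  Σ-*ˡ : ∀ n x g → x * Σ< F n g ≈ Σ< F n (λ i → x * g i)
  Σ-*ˡ zero    x g = zeroʳ x
  Σ-*ˡ (suc n) x g = trans (distribˡ x _ _) (+-congʳ (Σ-*ˡ n x g))

  Σ-*ʳ : ∀ n x g → Σ< F n g * x ≈ Σ< F n (λ i → g i * x)
  Σ-*ʳ n x g = trans (*-comm _ x) (trans (Σ-*ˡ n x g) (Σ-cong n (λ i _ → *-comm x (g i))))

  Σ-neg : ∀ n g → - Σ< F n g ≈ Σ< F n (λ i → - g i)
  Σ-neg zero    g = -0#≈0#
  Σ-neg (suc n) g = trans (sym (-‿+-comm _ _)) (+-congʳ (Σ-neg n g))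

  Σ-- : ∀ n g h → Σ< F n (λ i → g i - h i) ≈ Σ< F n g - Σ< F n h
  Σ-- n g h = trans (Σ-+ n g (λ i → - h i)) (+-congˡ (sym (Σ-neg n h)))

  Σ-swap : ∀ m n (g : ℕ → ℕ → Carrier) →
           Σ< F m (λ i → Σ< F n (g i)) ≈ Σ< F n (λ j → Σ< F m (λ i → g i j))
  Σ-swap zero    n g = sym (Σ-0 n (λ _ _ → refl))
  Σ-swap (suc m) n g = trans (+-congʳ (Σ-swap m n g)) (sym (Σ-+ n _ _))

  Σ-telescope : ∀ n (x : ℕ → Carrier) → Σ< F n (λ i → x (suc i) - x i) ≈ x n - x 0
  Σ-telescope zero    x = sym (-‿inverseʳ (x 0))
  Σ-telescope (suc n) x = trans (+-congʳ (Σ-telescope n x)) (sub-+-sub _ _ _)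

  Σ-extend : ∀ {n} N g → n ≤ N → (∀ i → n ≤ i → i < N → g i ≈ 0#) → Σ< F N g ≈ Σ< F n g
  Σ-extend {n} N g n≤N vanish with ℕP.m≤n⇒m<n∨m≡n n≤N
  ... | ⊎.inj₂ ≡.refl = refl
  Σ-extend {n} (suc N) g n≤N vanish | ⊎.inj₁ n<1+N =
    trans (+-cong (Σ-extend N g n≤N′ (λ i n≤i i<N → vanish i n≤i (ℕP.m<n⇒m<1+n i<N)))
                  (vanish N n≤N′ ℕP.≤-refl))
          (+-identityʳ _)
    where
    n≤N′ : n ≤ N
    n≤N′ = ℕP.≤-pred n<1+N

  Σ-single : ∀ n k g → k < n → (∀ i → i < n → i ≢ k → g i ≈ 0#) → Σ< F n g ≈ g k
  Σ-single (suc n) k g k<1+n others with ℕP.m≤n⇒m<n∨m≡n (ℕP.≤-pred k<1+n)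
  ... | ⊎.inj₂ ≡.refl =
    trans (+-congʳ (Σ-0 n (λ i i<n → others i (ℕP.m<n⇒m<1+n i<n) (ℕP.<⇒≢ i<n)))) (+-identityˡ _)
  ... | ⊎.inj₁ k<n =
    trans (+-cong (Σ-single n k g k<n (λ i i<n → others i (ℕP.m<n⇒m<1+n i<n)))
                  (others n ℕP.≤-refl (λ n≡k → ℕP.<⇒≢ k<n (≡.sym n≡k))))
          (+-identityʳ _)

  Σ-split : ∀ m n g → Σ< F (m ℕ.+ n) g ≈ Σ< F n g + Σ< F m (λ i → g (i ℕ.+ n))
  Σ-split zero    n g = sym (+-identityʳ _)
  Σ-split (suc m) n g = trans (+-congʳ (Σ-split m n g)) (+-assoc _ _ _)

  Σ-shift : ∀ n g → Σ< F (suc n) g ≈ g 0 + Σ< F n (λ i → g (suc i))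
  Σ-shift zero    g = trans (+-identityˡ _) (sym (+-identityʳ _))
  Σ-shift (suc n) g = trans (+-congʳ (Σ-shift n g)) (+-assoc _ _ _)

  Σ-reverse : ∀ n g → Σ< F n g ≈ Σ< F n (λ i → g (n ∸ suc i))
  Σ-reverse zero    g = refl
  Σ-reverse (suc n) g = begin
    Σ< F n g + g n                              ≈⟨ +-comm _ _ ⟩
    g n + Σ< F n g                              ≈⟨ +-congˡ (Σ-reverse n g) ⟩
    g n + Σ< F n (λ i → g (n ∸ suc i))          ≈⟨ sym (Σ-shift n (λ i → g (n ∸ i))) ⟩
    Σ< F (suc n) (λ i → g (n ∸ i))              ∎

  Σfilter : ℕ → (ℕ → Bool) → (ℕ → Carrier) → Carrier
  Σfilter n φ g = Σ1 F n (λ d → [ φ d ]· g d)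

  Σfilter-cong : ∀ n φ g h → (∀ i → i < n → φ (suc i) ≡ true → g (suc i) ≈ h (suc i)) →
                 Σfilter n φ g ≈ Σfilter n φ h
  Σfilter-cong n φ g h eq = Σ-cong n (λ i i<n → [·]-congᵗ (φ (suc i)) (eq i i<n))

  Σfilter-+ : ∀ n φ g h → Σfilter n φ (λ d → g d + h d) ≈ Σfilter n φ g + Σfilter n φ h
  Σfilter-+ n φ g h = trans (Σ-cong n (λ i _ → [·]-+ (φ (suc i)) _ _)) (Σ-+ n _ _)

  Σfilter-- : ∀ n φ g h → Σfilter n φ (λ d → g d - h d) ≈ Σfilter n φ g - Σfilter n φ h
  Σfilter-- n φ g h = begin
    Σfilter n φ (λ d → g d - h d)
      ≈⟨ Σ-cong n (λ i _ → trans ([·]-+ (φ (suc i)) _ _) (+-congˡ ([·]-neg (φ (suc i)) _))) ⟩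
    Σ1 F n (λ d → [ φ d ]· g d - [ φ d ]· h d)  ≈⟨ Σ-- n _ _ ⟩
    Σfilter n φ g - Σfilter n φ h               ∎

  Σfilter-*ˡ : ∀ n φ x g → x * Σfilter n φ g ≈ Σfilter n φ (λ d → x * g d)
  Σfilter-*ˡ n φ x g = trans (Σ-*ˡ n x _) (Σ-cong n (λ i _ → [·]-*ˡ (φ (suc i)) x _))

  Σfilter-Σ : ∀ n φ m (g : ℕ → ℕ → Carrier) →
              Σfilter n φ (λ d → Σ< F m (g d)) ≈ Σ< F m (λ j → Σfilter n φ (λ d → g d j))
  Σfilter-Σ n φ m g = trans (Σ-cong n (λ i _ → [·]-Σ (φ (suc i)))) (Σ-swap n m _)
    where
    [·]-Σ : ∀ b {h : ℕ → Carrier} → [ b ]· Σ< F m h ≈ Σ< F m (λ j → [ b ]· h j)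
    [·]-Σ true  = refl
    [·]-Σ false = sym (Σ-0 m (λ _ _ → refl))

  divisor? proper-divisor? : ℕ → ℕ → Bool
  divisor? n d        = does (d ∣? n)
  proper-divisor? n d = does (d ∣? n) ∧ (2 ≤ᵇ d)

  Σdiv-cong : ∀ n {g h} → (∀ i → suc i ∣ n → g (suc i) ≈ h (suc i)) → Σdiv F n g ≈ Σdiv F n h
  Σdiv-cong n {g} {h} eq = Σfilter-cong n (divisor? n) g h (λ i _ φ≡t → eq i (witness (suc i ∣? n) φ≡t))

  Σdiv>1-cong : ∀ n {g h} → (∀ i → suc i ∣ n → 1 ≤ i → g (suc i) ≈ h (suc i)) → Σdiv>1 F n g ≈ Σdiv>1 F n h
  Σdiv>1-cong n {g} {h} eq = Σfilter-cong n (proper-divisor? n) g h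
    (λ i _ φ≡t → let (i+1∣n , 1≤i) = divisor>1 n i φ≡t in eq i i+1∣n 1≤i)

  Σdiv-split : ∀ n g → 1 ≤ n → Σdiv F n g ≈ g 1 + Σdiv>1 F n g
  Σdiv-split n@(suc m) g _ = begin
    Σdiv F n g                    ≈⟨ Σ-shift m _ ⟩
    [ does (1 ∣? n) ]· g 1 + rest ≈⟨ +-congʳ ([·]-true (g 1) (dec-true (1 ∣? n) (1∣ n))) ⟩
    g 1 + rest                    ≈⟨ +-congˡ (sym rest≈) ⟩
    g 1 + Σdiv>1 F n g            ∎
    where
    rest : Carrier
    rest = Σ< F m (λ i → [ does (suc (suc i) ∣? n) ]· g (suc (suc i)))
    rest≈ : Σdiv>1 F n g ≈ rest
    rest≈ = begin
      Σdiv>1 F n g    ≈⟨ Σ-shift m _ ⟩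
      [ does (1 ∣? n) ∧ false ]· g 1 + Σ< F m (λ i → [ does (suc (suc i) ∣? n) ∧ true ]· g (suc (suc i)))
                      ≈⟨ +-cong ([·]-false (g 1) (∧-zeroʳ _))
                                (Σ-cong m (λ i _ → ≡⇒≈ (≡.cong (λ b → [ b ]· g (suc (suc i))) (∧-identityʳ _)))) ⟩
      0# + rest       ≈⟨ +-identityˡ rest ⟩
      rest            ∎

  -- Dirichlet convolution g ⋆ Z uses all divisors; g ⋆>1 Z only those d > 1, so it only
  -- involves the values Z e with e < n.

  conv : (ℕ → ℕ → Bool) → (ℕ → Carrier) → (ℕ → Carrier) → ℕ → Carrier
  conv φ g Z n = Σfilter n (φ n) (λ d → g d * Z (n div d))

  infixl 7 _⋆_ _⋆>1_
  _⋆_ _⋆>1_ : (ℕ → Carrier) → (ℕ → Carrier) → ℕ → Carrier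
  _⋆_   = conv divisor?
  _⋆>1_ = conv proper-divisor?

  conv-cong : ∀ φ g Z Z′ n → (∀ e → Z e ≈ Z′ e) → conv φ g Z n ≈ conv φ g Z′ n
  conv-cong φ g Z Z′ n eq =
    Σfilter-cong n (φ n) (λ d → g d * Z (n div d)) (λ d → g d * Z′ (n div d)) (λ _ _ _ → *-congˡ (eq _))

  conv-+ : ∀ φ g Z Z′ n → conv φ g (λ e → Z e + Z′ e) n ≈ conv φ g Z n + conv φ g Z′ n
  conv-+ φ g Z Z′ n =
    trans (Σfilter-cong n (φ n) (λ d → g d * (Z (n div d) + Z′ (n div d)))
                                (λ d → g d * Z (n div d) + g d * Z′ (n div d)) (λ _ _ _ → distribˡ _ _ _))
          (Σfilter-+ n (φ n) (λ d → g d * Z (n div d)) (λ d → g d * Z′ (n div d)))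

  conv-- : ∀ φ g Z Z′ n → conv φ g (λ e → Z e - Z′ e) n ≈ conv φ g Z n - conv φ g Z′ n
  conv-- φ g Z Z′ n =
    trans (Σfilter-cong n (φ n) (λ d → g d * (Z (n div d) - Z′ (n div d)))
                                (λ d → g d * Z (n div d) - g d * Z′ (n div d)) (λ _ _ _ → *-distribˡ-- _ _ _))
          (Σfilter-- n (φ n) (λ d → g d * Z (n div d)) (λ d → g d * Z′ (n div d)))

  conv-*ˡ : ∀ φ g x Z n → conv φ g (λ e → x * Z e) n ≈ x * conv φ g Z n
  conv-*ˡ φ g x Z n =
    trans (Σfilter-cong n (φ n) (λ d → g d * (x * Z (n div d)))
                                (λ d → x * (g d * Z (n div d))) (λ _ _ _ → *-CS.x∙yz≈y∙xz _ x _))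
          (sym (Σfilter-*ˡ n (φ n) x (λ d → g d * Z (n div d))))

  conv-Σ : ∀ φ g N (Z : ℕ → ℕ → Carrier) n →
           conv φ g (λ e → Σ< F N (λ j → Z j e)) n ≈ Σ< F N (λ j → conv φ g (Z j) n)
  conv-Σ φ g N Z n =
    trans (Σfilter-cong n (φ n) (λ d → g d * Σ< F N (λ j → Z j (n div d)))
                                (λ d → Σ< F N (λ j → g d * Z j (n div d))) (λ _ _ _ → Σ-*ˡ N _ _))
          (Σfilter-Σ n (φ n) N (λ d j → g d * Z j (n div d)))

  ⋆-cong : ∀ g Z Z′ n → 1 ≤ n → (∀ e → e ≤ n → Z e ≈ Z′ e) → (g ⋆ Z) n ≈ (g ⋆ Z′) n
  ⋆-cong g Z Z′ n 1≤n eq =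
    Σdiv-cong n {λ d → g d * Z (n div d)} {λ d → g d * Z′ (n div d)} (λ i _ →
      *-congˡ (eq _ (m/n≤m n (suc i))))

  ⋆>1-cong : ∀ g Z Z′ n → 1 ≤ n → (∀ e → 1 ≤ e → e < n → Z e ≈ Z′ e) → (g ⋆>1 Z) n ≈ (g ⋆>1 Z′) n
  ⋆>1-cong g Z Z′ n 1≤n eq =
    Σdiv>1-cong n {λ d → g d * Z (n div d)} {λ d → g d * Z′ (n div d)} (λ i i+1∣n 1≤i →
      *-congˡ (eq _ (quotient-pos i i+1∣n 1≤n) (quotient-< i 1≤n 1≤i)))

  ⋆-split : ∀ g Z n → 1 ≤ n → (g ⋆ Z) n ≈ g 1 * Z n + (g ⋆>1 Z) n
  ⋆-split g Z n 1≤n =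
    trans (Σdiv-split n (λ d → g d * Z (n div d)) 1≤n) (+-congʳ (*-congˡ (≡⇒≈ (≡.cong Z (n/1≡n n)))))

  -- If g 1 ≠ 0, a function on the positive integers is determined by its convolution with g:
  -- (g ⋆ Z) n fixes Z n once the values Z e, e < n, are known.
  ⋆-injective : ∀ g Z Z′ → g 1 ≉ 0# → (∀ n → 1 ≤ n → (g ⋆ Z) n ≈ (g ⋆ Z′) n) →
                ∀ n → 1 ≤ n → Z n ≈ Z′ n
  ⋆-injective g Z Z′ g1≉0 eq = <-rec (λ n → 1 ≤ n → Z n ≈ Z′ n) step
    where
    step : ∀ n → (∀ {e} → e < n → 1 ≤ e → Z e ≈ Z′ e) → 1 ≤ n → Z n ≈ Z′ n
    step n ih 1≤n = *-cancelˡ g1≉0 (∙-cancelʳ ((g ⋆>1 Z) n) _ _ (begin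
      g 1 * Z n + (g ⋆>1 Z) n     ≈⟨ sym (⋆-split g Z n 1≤n) ⟩
      (g ⋆ Z) n                   ≈⟨ eq n 1≤n ⟩
      (g ⋆ Z′) n                  ≈⟨ ⋆-split g Z′ n 1≤n ⟩
      g 1 * Z′ n + (g ⋆>1 Z′) n   ≈⟨ +-congˡ (⋆>1-cong g Z′ Z n 1≤n (λ e 1≤e e<n → sym (ih e<n 1≤e))) ⟩
      g 1 * Z′ n + (g ⋆>1 Z) n    ∎))

  δ : ℕ → ℕ → Carrier
  δ k n = [ n ≡ᵇ k ]· 1#

  ⋆>1-vanish : ∀ g Z n → 1 ≤ n → (∀ e → 1 ≤ e → e < n → Z e ≈ 0#) → (g ⋆>1 Z) n ≈ 0#
  ⋆>1-vanish g Z n 1≤n vanish =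
    trans (⋆>1-cong g Z (λ _ → 0#) n 1≤n vanish)
          (Σ-0 n (λ i _ → trans ([·]-congᵗ (proper-divisor? n (suc i)) (λ _ → zeroʳ _)) ([·]-0 _)))

  ⋆>1-δ₁ : ∀ g n → 2 ≤ n → (g ⋆>1 δ 1) n ≈ g n
  ⋆>1-δ₁ g n@(suc (suc m)) (s≤s (s≤s z≤n)) = trans (Σ-single n (suc m) _ ℕP.≤-refl others) at-n
    where
    at-n : [ proper-divisor? n n ]· (g n * δ 1 (n / n)) ≈ g n
    at-n = begin
      [ proper-divisor? n n ]· (g n * δ 1 (n / n))
        ≈⟨ [·]-true _ (≡.trans (∧-identityʳ _) (dec-true (n ∣? n) ∣-refl)) ⟩
      g n * [ n / n ≡ᵇ 1 ]· 1#  ≈⟨ *-congˡ ([·]-true 1# (≡ᵇ-true (n/n≡1 n))) ⟩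
      g n * 1#                 ≈⟨ *-identityʳ (g n) ⟩
      g n                      ∎
    others : ∀ i → i < n → i ≢ suc m → [ proper-divisor? n (suc i) ]· (g (suc i) * δ 1 (n / suc i)) ≈ 0#
    others i _ i≢1+m = trans ([·]-congᵗ (proper-divisor? n (suc i)) not-n) ([·]-0 _)
      where
      not-n : proper-divisor? n (suc i) ≡ true → g (suc i) * δ 1 (n / suc i) ≈ 0#
      not-n φ≡t with divisor>1 n i φ≡t
      ... | i+1∣n , _ = trans (*-congˡ ([·]-false 1# (≡ᵇ-false q≢1))) (zeroʳ _)
        where
        q≢1 : n / suc i ≢ 1
        q≢1 q≡1 = i≢1+m (ℕP.suc-injective (≡.trans
          (≡.sym (≡.trans (≡.cong (ℕ._* suc i) q≡1) (ℕP.*-identityˡ (suc i))))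
          (m/n*n≡m i+1∣n)))

  -- Convolution powers of g restricted to divisors > 1: power>1 g j n sums g d₁ ⋯ g dⱼ over the
  -- factorisations n = d₁ ⋯ dⱼ with all dᵢ > 1.  There are none when 1 ≤ n ≤ j, as then n < 2ʲ.
  power>1 : (ℕ → Carrier) → ℕ → ℕ → Carrier
  power>1 g zero    = δ 1
  power>1 g (suc j) = g ⋆>1 power>1 g j

  power>1-vanish : ∀ g j n → 1 ≤ n → n ≤ j → power>1 g j n ≈ 0#
  power>1-vanish g zero    n 1≤n n≤0 = ⊥-elim (ℕP.<⇒≱ 1≤n n≤0)
  power>1-vanish g (suc j) n 1≤n n≤j+1 = ⋆>1-vanish g (power>1 g j) n 1≤n (λ e 1≤e e<n →
    power>1-vanish g j e 1≤e (ℕP.≤-pred (ℕP.≤-trans e<n n≤j+1)))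

  dilate : ℕ → (ℕ → Carrier) → ℕ → Carrier
  dilate k Z e = [ does (k ∣? e) ]· Z (e div k)

  dilate-multiple : ∀ k Z q → dilate (suc k) Z (q ℕ.* suc k) ≈ Z q
  dilate-multiple k Z q = trans ([·]-true _ (dec-true (suc k ∣? q ℕ.* suc k) (n∣m*n q)))
                                (≡⇒≈ (≡.cong Z (m*n/n≡m q (suc k))))

  dilate-off : ∀ k Z e → ¬ suc k ∣ e → dilate (suc k) Z e ≈ 0#
  dilate-off k Z e k∤e = [·]-false _ (dec-false (suc k ∣? e) k∤e)

  dilate-cong : ∀ k Z Z′ n → 1 ≤ n → (∀ e → 1 ≤ e → Z e ≈ Z′ e) → dilate (suc k) Z n ≈ dilate (suc k) Z′ n
  dilate-cong k Z Z′ n 1≤n eq =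
    [·]-congᵗ (does (suc k ∣? n)) (λ k∣n → eq _ (quotient-pos k (witness (suc k ∣? n) k∣n) 1≤n))

  dilate-δ : ∀ k x n → dilate (suc k) (λ e → [ e ≡ᵇ 1 ]· x) n ≈ [ n ≡ᵇ suc k ]· x
  dilate-δ k x n with suc k ∣? n
  ... | yes (divides-refl q) = trans (dilate-multiple k (λ e → [ e ≡ᵇ 1 ]· x) q)
                                     (≡⇒≈ (≡.cong (λ c → [ c ]· x) (≡.sym (*-≡ᵇ-cancelʳ q k))))
  ... | no k∤n = trans (dilate-off k (λ e → [ e ≡ᵇ 1 ]· x) n k∤n)
                       (sym ([·]-false x (≡ᵇ-false {n} {suc k} (λ { ≡.refl → k∤n ∣-refl }))))

  -- The d-th term of (g ⋆ dilate k Z) (m k) is the d-th term of (g ⋆ Z) m: d ∣ m k with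
  -- k ∣ m k / d holds exactly when d ∣ m, and then (m k / d) / k = m / d.
  ⋆-dilate-term : ∀ (g Z : ℕ → Carrier) k m i →
    [ divisor? (m ℕ.* suc k) (suc i) ]· (g (suc i) * dilate (suc k) Z ((m ℕ.* suc k) / suc i))
      ≈ [ divisor? m (suc i) ]· (g (suc i) * Z (m / suc i))
  ⋆-dilate-term g Z k m i with suc i ∣? m
  ... | yes i+1∣m = begin
    [ divisor? (m ℕ.* K) (suc i) ]· (g (suc i) * dilate K Z ((m ℕ.* K) / suc i))
      ≈⟨ [·]-true (g (suc i) * dilate K Z ((m ℕ.* K) / suc i))
                  (dec-true (suc i ∣? m ℕ.* K) (∣-trans i+1∣m (m∣m*n K))) ⟩
    g (suc i) * dilate K Z ((m ℕ.* K) / suc i)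
      ≈⟨ *-congˡ (trans (≡⇒≈ (≡.cong (dilate K Z) (*-/-∣ m K i i+1∣m))) (dilate-multiple k Z (m / suc i))) ⟩
    g (suc i) * Z (m / suc i)
      ≈⟨ sym ([·]-true (g (suc i) * Z (m / suc i)) (dec-true (suc i ∣? m) i+1∣m)) ⟩
    [ divisor? m (suc i) ]· (g (suc i) * Z (m / suc i)) ∎
    where
    K : ℕ
    K = suc k
  ... | no i+1∤m = trans (trans ([·]-congᵗ (divisor? (m ℕ.* suc k) (suc i)) off) ([·]-0 _))
                           (sym ([·]-false _ (dec-false (suc i ∣? m) i+1∤m)))
    where
    off : divisor? (m ℕ.* suc k) (suc i) ≡ true → g (suc i) * dilate (suc k) Z ((m ℕ.* suc k) / suc i) ≈ 0#
    off φ≡t = trans (*-congˡ (dilate-off k Z _ (λ k+1∣q →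
                i+1∤m (*-cancelʳ-∣ (suc k) (m∣n/o⇒o*m∣n (witness (suc i ∣? m ℕ.* suc k) φ≡t) k+1∣q)))))
                    (zeroʳ _)

  ⋆-dilate : ∀ g Z k n → 1 ≤ n → (g ⋆ dilate (suc k) Z) n ≈ dilate (suc k) (g ⋆ Z) n
  ⋆-dilate g Z k n 1≤n with suc k ∣? n
  ... | yes (divides-refl zero) = ⊥-elim (ℕP.<-irrefl ≡.refl 1≤n)
  ... | yes (divides-refl m@(suc _)) = begin
    (g ⋆ dilate K Z) (m ℕ.* K)
      ≈⟨ Σ-cong (m ℕ.* K) (λ i _ → ⋆-dilate-term g Z k m i) ⟩
    Σ< F (m ℕ.* K) (λ i → [ divisor? m (suc i) ]· (g (suc i) * Z (m / suc i)))
      ≈⟨ Σ-extend (m ℕ.* K) _ (ℕP.m≤m*n m K) beyond-m ⟩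
    (g ⋆ Z) m
      ≈⟨ sym (dilate-multiple k (g ⋆ Z) m) ⟩
    dilate K (g ⋆ Z) (m ℕ.* K) ∎
    where
    K : ℕ
    K = suc k
    beyond-m : ∀ i → m ≤ i → i < m ℕ.* K → [ divisor? m (suc i) ]· (g (suc i) * Z (m / suc i)) ≈ 0#
    beyond-m i m≤i _ = [·]-false _ (dec-false (suc i ∣? m) (λ i+1∣m → ℕP.<⇒≱ (s≤s m≤i) (∣⇒≤ i+1∣m)))
  ... | no k∤n = trans (Σ-0 n (λ i _ → trans ([·]-congᵗ (divisor? n (suc i)) (off i)) ([·]-0 _)))
                       (sym (dilate-off k (g ⋆ Z) n k∤n))
    where
    off : ∀ i → divisor? n (suc i) ≡ true → g (suc i) * dilate (suc k) Z (n / suc i) ≈ 0#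
    off i φ≡t = trans (*-congˡ (dilate-off k Z _ (λ k+1∣q →
                  k∤n (∣-trans k+1∣q (m/n∣m (witness (suc i ∣? n) φ≡t))))))
                      (zeroʳ _)

  -- The Dirichlet inverse of f̂ = fhat F f w: it is G = D + [· = 1] / f̂ 1.  Writing
  -- a = f̂ 1, b = a⁻¹, Pⱼ = power>1 f̂ j and εⱼ = bʲ Pⱼ, one has ds_{j+1} = P_{j+1} − a Pⱼ, so
  -- a G agrees on 1 … N with T N = ε₀ + Σ_{i<N} (ε_{2i+2} − ε_{2i+1}); and b (f̂ ⋆>1 εⱼ) = ε_{j+1}
  -- makes a G + f̂ ⋆>1 G telescope to ε₀ + ε_{2n+1} = δ 1 at n.
  module Inverse (f : ℕ → Carrier) (w : Carrier) (a≉0 : fhat F f w 1 ≉ 0#) where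

    f̂ : ℕ → Carrier
    f̂ = fhat F f w

    a b : Carrier
    a = f̂ 1
    b = a ⁻¹

    ab≈1 : a * b ≈ 1#
    ab≈1 = ⁻¹-inverse a a≉0

    P : ℕ → ℕ → Carrier
    P = power>1 f̂

    ε : ℕ → ℕ → Carrier
    ε j n = b ^ j * P j n

    ε-vanish : ∀ j n → 1 ≤ n → n ≤ j → ε j n ≈ 0#
    ε-vanish j n 1≤n n≤j = trans (*-congˡ (power>1-vanish f̂ j n 1≤n n≤j)) (zeroʳ _)

    ε-step : ∀ j n → b * (f̂ ⋆>1 ε j) n ≈ ε (suc j) n
    ε-step j n = trans (*-congˡ (conv-*ˡ proper-divisor? f̂ (b ^ j) (P j) n)) (sym (*-assoc b (b ^ j) _))

    -- ds_{j+1} = P_{j+1} − a Pⱼ: for j = 0 this is ds₁(n) = ± f̂(n) with the sign − exactly at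
    -- n = 1, and both sides satisfy the same recursion.
    ds≈ : ∀ j n → 1 ≤ n → ds F f w j n ≈ P (suc j) n - a * P j n
    ds≈ zero (suc zero) _ = sym (trans (+-cong (+-identityʳ 0#) (-‿cong (*-identityʳ a))) (+-identityˡ _))
    ds≈ zero n@(suc (suc m)) _ = begin
      f̂ n                           ≈⟨ sym (⋆>1-δ₁ f̂ n (s≤s (s≤s z≤n))) ⟩
      P 1 n                         ≈⟨ sym (+-identityʳ _) ⟩
      P 1 n + 0#                    ≈⟨ +-congˡ (sym (trans (-‿cong (zeroʳ a)) -0#≈0#)) ⟩
      P 1 n - a * 0#                ∎
    ds≈ (suc j) n 1≤n = begin
      (f̂ ⋆>1 ds F f w j) n                               ≈⟨ ⋆>1-cong f̂ _ _ n 1≤n (λ e 1≤e _ → ds≈ j e 1≤e) ⟩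
      (f̂ ⋆>1 (λ e → P (suc j) e - a * P j e)) n          ≈⟨ conv-- proper-divisor? f̂ (P (suc j)) (λ e → a * P j e) n ⟩
      P (suc (suc j)) n - (f̂ ⋆>1 (λ e → a * P j e)) n    ≈⟨ +-congˡ (-‿cong (conv-*ˡ proper-divisor? f̂ a (P j) n)) ⟩
      P (suc (suc j)) n - a * P (suc j) n                ∎

    1+2i 2+2i 3+2i : ℕ → ℕ
    1+2i i = suc (2 ℕ.* i)
    2+2i i = suc (1+2i i)
    3+2i i = suc (2+2i i)

    D-term : ∀ i n → 1 ≤ n →
             ds F f w (2 ℕ.* suc i ∸ 1) n * (a ^ (2 ℕ.* suc i ℕ.+ 1)) ⁻¹
               ≈ b * (ε (2+2i i) n - ε (1+2i i) n)
    D-term i n 1≤n = begin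
      ds F f w (2 ℕ.* suc i ∸ 1) n * (a ^ (2 ℕ.* suc i ℕ.+ 1)) ⁻¹
        ≈⟨ *-cong (≡⇒≈ (≡.cong (λ j → ds F f w j n) ds-index))
                  (trans (^-⁻¹ (2 ℕ.* suc i ℕ.+ 1) a≉0) (≡⇒≈ (≡.cong (b ^_) power-index))) ⟩
      ds F f w (1+2i i) n * (b * (b * B))              ≈⟨ *-congʳ (ds≈ (1+2i i) n 1≤n) ⟩
      (X - a * Y) * (b * (b * B))                      ≈⟨ distribʳ _ X (- (a * Y)) ⟩
      X * (b * (b * B)) + - (a * Y) * (b * (b * B))    ≈⟨ +-cong (*-CS.x∙yz≈y∙xz X b _) (sym (-‿distribˡ-* _ _)) ⟩
      b * (X * (b * B)) - (a * Y) * (b * (b * B))      ≈⟨ +-congˡ (-‿cong aY-term) ⟩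
      b * (X * (b * B)) - b * (Y * B)                  ≈⟨ sym (*-distribˡ-- b _ _) ⟩
      b * (X * (b * B) - Y * B)                        ≈⟨ *-congˡ (+-cong (*-comm X _) (-‿cong (*-comm Y B))) ⟩
      b * (ε (2+2i i) n - ε (1+2i i) n) ∎
      where
      X Y B : Carrier
      X = P (2+2i i) n
      Y = P (1+2i i) n
      B = b ^ 1+2i i
      ds-index : 2 ℕ.* suc i ∸ 1 ≡ 1+2i i
      ds-index = ≡.cong (_∸ 1) (ℕP.*-suc 2 i)
      power-index : 2 ℕ.* suc i ℕ.+ 1 ≡ 3+2i i
      power-index = ≡.trans (≡.cong (ℕ._+ 1) (ℕP.*-suc 2 i))
                            (≡.cong (λ m → suc (suc m)) (ℕP.+-comm (2 ℕ.* i) 1))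
      aY-term : (a * Y) * (b * (b * B)) ≈ b * (Y * B)
      aY-term = begin
        (a * Y) * (b * (b * B))
          ≈⟨ solve 4 (λ a Y b B → (a :* Y) :* (b :* (b :* B)) := (a :* b) :* (b :* (Y :* B))) refl a Y b B ⟩
        (a * b) * (b * (Y * B))    ≈⟨ *-congʳ ab≈1 ⟩
        1# * (b * (Y * B))         ≈⟨ *-identityˡ _ ⟩
        b * (Y * B)                ∎

    -- pairs N = Σ_{i<N} (ε_{2i+2} − ε_{2i+1}); on 1 … N, a G agrees with T N = ε₀ + pairs N,
    -- since D = b pairs n at n, [n = 1] = ε₀(n), and the pairs with i ≥ n vanish at n.
    pairs : ℕ → ℕ → Carrier
    pairs N n = Σ< F N (λ i → ε (2+2i i) n - ε (1+2i i) n)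

    T : ℕ → ℕ → Carrier
    T N n = ε 0 n + pairs N n

    G : ℕ → Carrier
    G n = D F f w n + [ n ≡ᵇ 1 ]· b

    G≈bT : ∀ N n → 1 ≤ n → n ≤ N → G n ≈ b * T N n
    G≈bT N n 1≤n n≤N = begin
      D F f w n + [ n ≡ᵇ 1 ]· b
        ≈⟨ +-cong (trans (Σ-cong n (λ i _ → D-term i n 1≤n)) (sym (Σ-*ˡ n b _))) (unit (n ≡ᵇ 1)) ⟩
      b * pairs n n + b * ε 0 n      ≈⟨ +-comm _ _ ⟩
      b * ε 0 n + b * pairs n n      ≈⟨ sym (distribˡ b _ _) ⟩
      b * T n n                      ≈⟨ *-congˡ (+-congˡ (sym (Σ-extend N _ n≤N pairs-vanish))) ⟩
      b * T N n                      ∎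
      where
      unit : ∀ c → [ c ]· b ≈ b * (1# * [ c ]· 1#)
      unit true  = sym (trans (*-congˡ (*-identityˡ 1#)) (*-identityʳ b))
      unit false = sym (trans (*-congˡ (zeroʳ 1#)) (zeroʳ b))
      pairs-vanish : ∀ i → n ≤ i → i < N → ε (2+2i i) n - ε (1+2i i) n ≈ 0#
      pairs-vanish i n≤i _ = begin
        ε (2+2i i) n - ε (1+2i i) n
          ≈⟨ +-cong (ε-vanish _ n 1≤n (ℕP.≤-trans n≤2i+1 (ℕP.n≤1+n _))) (-‿cong (ε-vanish _ n 1≤n n≤2i+1)) ⟩
        0# - 0#  ≈⟨ -‿inverseʳ 0# ⟩
        0#       ∎
        where
        n≤2i+1 : n ≤ suc (2 ℕ.* i)
        n≤2i+1 = ℕP.≤-trans n≤i (ℕP.≤-trans (ℕP.m≤n*m i 2) (ℕP.n≤1+n _))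

    ⋆>1-T : ∀ N n → b * (f̂ ⋆>1 T N) n
                      ≈ ε 1 n + Σ< F N (λ i → ε (3+2i i) n - ε (2+2i i) n)
    ⋆>1-T N n = begin
      b * (f̂ ⋆>1 T N) n
        ≈⟨ *-congˡ (conv-+ proper-divisor? f̂ (ε 0) (pairs N) n) ⟩
      b * ((f̂ ⋆>1 ε 0) n + (f̂ ⋆>1 pairs N) n)
        ≈⟨ *-congˡ (+-congˡ (trans (conv-Σ proper-divisor? f̂ N (λ i e → ε (2+2i i) e - ε (1+2i i) e) n)
                                  (Σ-cong N (λ i _ → conv-- proper-divisor? f̂ (ε (2+2i i)) (ε (1+2i i)) n)))) ⟩
      b * ((f̂ ⋆>1 ε 0) n + Σ< F N (λ i → (f̂ ⋆>1 ε (2+2i i)) n - (f̂ ⋆>1 ε (1+2i i)) n))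
        ≈⟨ distribˡ b _ _ ⟩
      b * (f̂ ⋆>1 ε 0) n + b * Σ< F N (λ i → (f̂ ⋆>1 ε (2+2i i)) n - (f̂ ⋆>1 ε (1+2i i)) n)
        ≈⟨ +-cong (ε-step 0 n) (trans (Σ-*ˡ N b _) (Σ-cong N (λ i _ →
             trans (*-distribˡ-- b _ _) (+-cong (ε-step (2+2i i) n) (-‿cong (ε-step (1+2i i) n)))))) ⟩
      ε 1 n + Σ< F N (λ i → ε (3+2i i) n - ε (2+2i i) n)
        ∎

    inverse : ∀ n → 1 ≤ n → (f̂ ⋆ G) n ≈ δ 1 n
    inverse n 1≤n = begin
      (f̂ ⋆ G) n
        ≈⟨ ⋆-split f̂ G n 1≤n ⟩
      a * G n + (f̂ ⋆>1 G) n
        ≈⟨ +-cong (*-congˡ (G≈bT n n 1≤n ℕP.≤-refl))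
                  (⋆>1-cong f̂ G (λ e → b * T n e) n 1≤n (λ e 1≤e e<n → G≈bT n e 1≤e (ℕP.<⇒≤ e<n))) ⟩
      a * (b * T n n) + (f̂ ⋆>1 (λ e → b * T n e)) n
        ≈⟨ +-cong (trans (sym (*-assoc a b _)) (trans (*-congʳ ab≈1) (*-identityˡ _)))
                  (conv-*ˡ proper-divisor? f̂ b (T n) n) ⟩
      (ε 0 n + pairs n n) + b * (f̂ ⋆>1 T n) n
        ≈⟨ +-congˡ (⋆>1-T n n) ⟩
      (ε 0 n + pairs n n) + (ε 1 n + Σ< F n (λ i → ε (3+2i i) n - ε (2+2i i) n))
        ≈⟨ solve 4 (λ x y z t → (x :+ y) :+ (z :+ t) := x :+ (z :+ (y :+ t))) refl _ _ _ _ ⟩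
      ε 0 n + (ε 1 n + (pairs n n + Σ< F n (λ i → ε (3+2i i) n - ε (2+2i i) n)))
        ≈⟨ +-congˡ (+-congˡ (trans (sym (Σ-+ n _ _)) (Σ-cong n (λ i _ → sub-+-sub _ _ _)))) ⟩
      ε 0 n + (ε 1 n + Σ< F n (λ i → ε (3+2i i) n - ε (1+2i i) n))
        ≈⟨ +-congˡ (+-congˡ (trans (Σ-cong n (λ i _ → +-congʳ (≡⇒≈ (≡.cong (λ j → ε (suc j) n) (≡.sym (ℕP.*-suc 2 i))))))
                                   (Σ-telescope n (λ i → ε (1+2i i) n)))) ⟩
      ε 0 n + (ε 1 n + (ε (1+2i n) n - ε 1 n))
        ≈⟨ +-congˡ (+-sub-cancel _ _) ⟩
      ε 0 n + ε (1+2i n) n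
        ≈⟨ +-cong (*-identityˡ _) (ε-vanish _ n 1≤n (ℕP.≤-trans (ℕP.m≤n*m n 2) (ℕP.n≤1+n _))) ⟩
      δ 1 n + 0#
        ≈⟨ +-identityʳ _ ⟩
      δ 1 n
        ∎

  multiples-sum : Carrier → ℕ → ℕ → Carrier
  multiples-sum x d N = Σ1 F N (λ m → [ divisor? m d ]· x ^ m)

  multiples-block : ∀ x d q →
    Σ< F (suc d) (λ i → [ divisor? (suc (i ℕ.+ q ℕ.* suc d)) (suc d) ]· x ^ suc (i ℕ.+ q ℕ.* suc d))
      ≈ x ^ suc d * x ^ (q ℕ.* suc d)
  multiples-block x d q =
    trans (Σ-single (suc d) d _ ℕP.≤-refl others)
          (trans ([·]-true _ (dec-true (suc d ∣? suc q ℕ.* suc d) (n∣m*n (suc q)))) (^-+ x (suc d) (q ℕ.* suc d)))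
    where
    others : ∀ i → i < suc d → i ≢ d →
             [ divisor? (suc (i ℕ.+ q ℕ.* suc d)) (suc d) ]· x ^ suc (i ℕ.+ q ℕ.* suc d) ≈ 0#
    others i i<1+d i≢d = [·]-false _ (dec-false (suc d ∣? _) (λ d∣m →
      let d∣1+i = ∣m+n∣m⇒∣n (≡.subst (suc d ∣_) (ℕP.+-comm (suc i) (q ℕ.* suc d)) d∣m) (n∣m*n q)
      in i≢d (ℕP.≤-antisym (ℕP.≤-pred i<1+d) (ℕP.≤-pred (∣⇒≤ d∣1+i)))))

  multiples-sum-closed : ∀ x d q →
    (x ^ suc d - 1#) * multiples-sum x (suc d) (q ℕ.* suc d) ≈ x ^ suc d * (x ^ (q ℕ.* suc d) - 1#)
  multiples-sum-closed x d zero = trans (zeroʳ _) (sym (trans (*-congˡ (-‿inverseʳ 1#)) (zeroʳ _)))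
  multiples-sum-closed x d (suc q) = begin
    (W - 1#) * multiples-sum x (suc d) (suc d ℕ.+ q ℕ.* suc d)
      ≈⟨ *-congˡ (trans (Σ-split (suc d) (q ℕ.* suc d) _) (+-congˡ (multiples-block x d q))) ⟩
    (W - 1#) * (multiples-sum x (suc d) (q ℕ.* suc d) + W * V)
      ≈⟨ distribˡ _ _ _ ⟩
    (W - 1#) * multiples-sum x (suc d) (q ℕ.* suc d) + (W - 1#) * (W * V)
      ≈⟨ +-cong (trans (multiples-sum-closed x d q) (*-distribˡ-- W V 1#))
                (trans (*-distribʳ-- (W * V) W 1#) (+-congˡ (-‿cong (*-identityˡ _)))) ⟩
    (W * V - W * 1#) + (W * (W * V) - W * V)
      ≈⟨ sub-+-sub _ _ _ ⟩
    W * (W * V) - W * 1#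
      ≈⟨ sym (*-distribˡ-- W (W * V) 1#) ⟩
    W * (W * V - 1#)
      ≈⟨ *-congˡ (+-congʳ (sym (^-+ x (suc d) (q ℕ.* suc d)))) ⟩
    W * (x ^ (suc d ℕ.+ q ℕ.* suc d) - 1#) ∎
    where
    W V : Carrier
    W = x ^ suc d
    V = x ^ (q ℕ.* suc d)

  multiples-sum-∣ : ∀ x d n → x ^ suc d ≉ 1# → suc d ∣ n →
                    multiples-sum x (suc d) n ≈ (x ^ suc d * (x ^ suc d - 1#) ⁻¹) * (x ^ n - 1#)
  multiples-sum-∣ x d n W≉1 (divides-refl q) = *-cancelˡ W-1≉0 (begin
    (W - 1#) * multiples-sum x (suc d) (q ℕ.* suc d)    ≈⟨ multiples-sum-closed x d q ⟩
    W * (x ^ n - 1#)                                    ≈⟨ sym (*-identityˡ _) ⟩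
    1# * (W * (x ^ n - 1#))                             ≈⟨ *-congʳ (sym (⁻¹-inverse _ W-1≉0)) ⟩
    ((W - 1#) * (W - 1#) ⁻¹) * (W * (x ^ n - 1#))
      ≈⟨ solve 4 (λ a b c d → (a :* b) :* (c :* d) := a :* ((c :* b) :* d)) refl _ _ _ _ ⟩
    (W - 1#) * ((W * (W - 1#) ⁻¹) * (x ^ n - 1#))       ∎)
    where
    W : Carrier
    W = x ^ suc d
    W-1≉0 : W - 1# ≉ 0#
    W-1≉0 eq = W≉1 (sub≈0⇒≈ eq)

  Σdiv-gcd : ∀ m n (h : ℕ → Carrier) → 1 ≤ n →
             Σdiv F (gcd m n) h ≈ Σ1 F n (λ d → [ divisor? m d ∧ divisor? n d ]· h d)
  Σdiv-gcd m n@(suc _) h _ = begin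
    Σdiv F g h                                          ≈⟨ sym (Σ-extend n _ (∣⇒≤ (gcd[m,n]∣n m n)) beyond-g) ⟩
    Σ1 F n (λ d → [ divisor? g d ]· h d)
      ≈⟨ Σ-cong n (λ i _ → ≡⇒≈ (≡.cong (λ c → [ c ]· h (suc i)) (∣gcd≡∧ (suc i) m n))) ⟩
    Σ1 F n (λ d → [ divisor? m d ∧ divisor? n d ]· h d) ∎
    where
    g : ℕ
    g = gcd m n
    instance
      g≢0 : ℕ.NonZero g
      g≢0 = ℕ.≢-nonZero (gcd[m,n]≢0 m n (⊎.inj₂ (λ ())))
    beyond-g : ∀ i → g ≤ i → i < n → [ divisor? g (suc i) ]· h (suc i) ≈ 0#
    beyond-g i g≤i _ = [·]-false _ (dec-false (suc i ∣? g) (λ i+1∣g → ℕP.<⇒≱ (s≤s g≤i) (∣⇒≤ i+1∣g)))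

  Σ-gcd : ∀ n (h y : ℕ → Carrier) → 1 ≤ n →
    Σ1 F n (λ m → Σdiv F (gcd m n) h * y m) ≈ Σdiv F n (λ d → h d * Σ1 F n (λ m → [ divisor? m d ]· y m))
  Σ-gcd n h y 1≤n = begin
    Σ1 F n (λ m → Σdiv F (gcd m n) h * y m)
      ≈⟨ Σ-cong n (λ i _ → trans (*-congʳ (Σdiv-gcd (suc i) n h 1≤n))
                                 (trans (Σ-*ʳ n _ _) (Σ-cong n (λ j _ → [·]-∧-* _ _ _ _)))) ⟩
    Σ1 F n (λ m → Σ1 F n (λ d → ([ divisor? n d ]· h d) * ([ divisor? m d ]· y m)))
      ≈⟨ Σ-swap n n _ ⟩
    Σ1 F n (λ d → Σ1 F n (λ m → ([ divisor? n d ]· h d) * ([ divisor? m d ]· y m)))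
      ≈⟨ Σ-cong n (λ j _ → trans (sym (Σ-*ˡ n _ _)) ([·]-*ʳ (divisor? n (suc j)) _ _)) ⟩
    Σdiv F n (λ d → h d * Σ1 F n (λ m → [ divisor? m d ]· y m)) ∎

  -- Σ_{j=1}^{n} p(e − j) v j = Σ_{i<e} p(i) v (e − i) for e ≤ n, as p(e − j) = 0 for j > e.
  Σ-pSub : ∀ (v : ℕ → Carrier) e n → e ≤ n →
           Σ1 F n (λ j → ι F (pSub e j) * v j) ≈ Σ< F e (λ i → ι F (p i) * v (e ∸ i))
  Σ-pSub v e n e≤n = begin
    Σ1 F n (λ j → ι F (pSub e j) * v j)
      ≈⟨ Σ-extend n _ e≤n (λ i e≤i _ →
           trans (*-congʳ (≡⇒≈ (≡.cong (pSub-at i) (≤ᵇ-false (ℕP.<⇒≱ (s≤s e≤i)))))) (zeroˡ _)) ⟩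
    Σ1 F e (λ j → ι F (pSub e j) * v j)
      ≈⟨ Σ-cong e (λ i i<e → *-cong (≡⇒≈ (≡.cong (pSub-at i) (≤ᵇ-true i<e)))
                                   (≡⇒≈ (≡.cong v (≡.sym (ℕP.m∸[m∸n]≡n i<e))))) ⟩
    Σ< F e (λ i → ι F (p (e ∸ suc i)) * v (e ∸ (e ∸ suc i)))
      ≈⟨ sym (Σ-reverse e (λ i → ι F (p i) * v (e ∸ i))) ⟩
    Σ< F e (λ i → ι F (p i) * v (e ∸ i)) ∎
    where
    pSub-at : ℕ → Bool → Carrier
    pSub-at i c = ι F (if c then p (e ∸ suc i) else 0)

  -- The matrix A factors through a Dirichlet convolution with f̂ (this needs wᵈ ≠ 1 for d ≥ 1):
  -- A n j = (wⁿ − 1) Σ_{d ∣ n} f̂ d p(n/d − j), and hence, for any column v,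
  -- Σ_j A n j v j = (wⁿ − 1) (f̂ ⋆ Y) n with Y e = Σ_{i<e} p(i) v(e − i).
  module Matrix (f : ℕ → Carrier) (w : Carrier) (w-nonroot : ∀ m → w ^ suc m ≉ 1#) where

    f̂ : ℕ → Carrier
    f̂ = fhat F f w

    A-factor : ∀ n j → 1 ≤ n → j ≤ n → A F f w n j ≈ (w ^ n - 1#) * (f̂ ⋆ (λ e → ι F (pSub e j))) n
    A-factor n j 1≤n j≤n = begin
      A F f w n j
        ≈⟨ [·]-true {j ≤ᵇ n} (Σ1 F n (λ m → Σdiv F (gcd m n) h * w ^ m)) (≤ᵇ-true j≤n) ⟩
      Σ1 F n (λ m → Σdiv F (gcd m n) h * w ^ m)
        ≈⟨ Σ-gcd n h (w ^_) 1≤n ⟩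
      Σdiv F n (λ d → h d * multiples-sum w d n)
        ≈⟨ Σdiv-cong n {λ d → h d * multiples-sum w d n} {λ d → V * (f̂ d * ι F (pSub (n div d) j))} (λ i i+1∣n →
             trans (*-congˡ (multiples-sum-∣ w i n (w-nonroot i) i+1∣n)) (regroup _ _ _ _)) ⟩
      Σdiv F n (λ d → V * (f̂ d * ι F (pSub (n div d) j)))
        ≈⟨ sym (Σfilter-*ˡ n (divisor? n) V (λ d → f̂ d * ι F (pSub (n div d) j))) ⟩
      V * (f̂ ⋆ (λ e → ι F (pSub e j))) n ∎
      where
      V : Carrier
      V = w ^ n - 1#
      h : ℕ → Carrier
      h d = f d * ι F (pSub (n div d) j)
      regroup : ∀ x y c v → (x * y) * (c * v) ≈ v * ((c * x) * y)
      regroup = solve 4 (λ x y c v → (x :* y) :* (c :* v) := v :* ((c :* x) :* y)) refl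

    column : ∀ (v : ℕ → Carrier) n → 1 ≤ n →
      Σ1 F n (λ j → A F f w n j * v j) ≈ (w ^ n - 1#) * (f̂ ⋆ (λ e → Σ< F e (λ i → ι F (p i) * v (e ∸ i)))) n
    column v n 1≤n = begin
      Σ1 F n (λ j → A F f w n j * v j)
        ≈⟨ Σ-cong n (λ i i<n → trans (*-congʳ (A-factor n (suc i) 1≤n i<n)) (*-assoc _ _ _)) ⟩
      Σ1 F n (λ j → V * ((f̂ ⋆ pSub-col j) n * v j))
        ≈⟨ sym (Σ-*ˡ n V _) ⟩
      V * Σ1 F n (λ j → (f̂ ⋆ pSub-col j) n * v j)
        ≈⟨ *-congˡ (Σ-cong n (λ i _ → trans (*-comm _ _) (sym (conv-*ˡ divisor? f̂ (v (suc i)) (pSub-col (suc i)) n)))) ⟩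
      V * Σ1 F n (λ j → (f̂ ⋆ (λ e → v j * pSub-col j e)) n)
        ≈⟨ *-congˡ (sym (conv-Σ divisor? f̂ n (λ i e → v (suc i) * pSub-col (suc i) e) n)) ⟩
      V * (f̂ ⋆ (λ e → Σ1 F n (λ j → v j * pSub-col j e))) n
        ≈⟨ *-congˡ (⋆-cong f̂ _ _ n 1≤n (λ e e≤n → trans (Σ-cong n (λ _ _ → *-comm _ _)) (Σ-pSub v e n e≤n))) ⟩
      V * (f̂ ⋆ (λ e → Σ< F e (λ i → ι F (p i) * v (e ∸ i)))) n ∎
      where
      V : Carrier
      V = w ^ n - 1#
      pSub-col : ℕ → ℕ → Carrier
      pSub-col j e = ι F (pSub e j)

  fhat1≉0 : ∀ f w → w ≉ 0# → w ^ 1 ≉ 1# → f 1 ≉ 0# → fhat F f w 1 ≉ 0#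
  fhat1≉0 f w w≉0 w≉1 f1≉0 = *-≉0 (*-≉0 (^-≉0 1 w≉0) (⁻¹-≉0 (λ eq → w≉1 (sub≈0⇒≈ eq)))) f1≉0

  -- If u is a right inverse of A in column k, then X e = Σ_{i<e} p(i) û_{e−i,k} satisfies
  -- f̂ ⋆ X = δ k: indeed X = (wᵏ − 1) Y and (wⁿ − 1) (f̂ ⋆ Y) n = Σ_j A n j u j k = δ k n.
  module Column (f : ℕ → Carrier) (w : Carrier) (w-nonroot : ∀ m → w ^ suc m ≉ 1#)
                (u : ℕ → ℕ → Carrier) (k : ℕ)
                (right-inverse : ∀ n → 1 ≤ n → Σ1 F n (λ j → A F f w n j * u j k) ≈ δ k n) where
    open Matrix f w w-nonroot

    Y X : ℕ → Carrier
    Y e = Σ< F e (λ i → ι F (p i) * u (e ∸ i) k)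
    X e = Σ< F e (λ i → ι F (p i) * uhat F f w u (e ∸ i) k)

    X≈ : ∀ e → X e ≈ (w ^ k - 1#) * Y e
    X≈ e = trans (Σ-cong e (λ i _ → *-CS.x∙yz≈y∙xz _ _ _)) (sym (Σ-*ˡ e _ _))

    f̂⋆X : ∀ n → 1 ≤ n → (f̂ ⋆ X) n ≈ δ k n
    f̂⋆X n@(suc n′) 1≤n = trans (trans (conv-cong divisor? f̂ X _ n X≈) (conv-*ˡ divisor? f̂ (w ^ k - 1#) Y n))
                              (scaled (n ≟ k))
      where
      col : (w ^ n - 1#) * (f̂ ⋆ Y) n ≈ δ k n
      col = trans (sym (column (λ j → u j k) n 1≤n)) (right-inverse n 1≤n)
      scaled : Dec (n ≡ k) → (w ^ k - 1#) * (f̂ ⋆ Y) n ≈ δ k n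
      scaled (yes ≡.refl) = col
      scaled (no n≢k) = trans (*-congˡ f̂⋆Y≈0) (trans (zeroʳ _) (sym δk≈0))
        where
        δk≈0 : δ k n ≈ 0#
        δk≈0 = [·]-false 1# (≡ᵇ-false n≢k)
        f̂⋆Y≈0 : (f̂ ⋆ Y) n ≈ 0#
        f̂⋆Y≈0 = *-cancelˡ (λ eq → w-nonroot n′ (sub≈0⇒≈ eq)) (trans col (trans δk≈0 (sym (zeroʳ _))))

-- Proposition 4.8.
proposition4p8 :
  ∀ {c ℓ : Level} (F : Field c ℓ) → CharZero F →
  let open Field F in
  (f : ℕ → Carrier) (w : Carrier) →
  ¬ (w ≈ 0#) →
  (∀ m → ¬ (pow F w (suc m) ≈ 1#)) →
  ¬ (f 1 ≈ 0#) →
  (u : ℕ → ℕ → Carrier) →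
  (∀ n k → 1 ≤ n → 1 ≤ k →
    Σ1 F n (λ j → A F f w n j * u j k) ≈ (if n ≡ᵇ k then 1# else 0#)) →
  ∀ n k → 1 ≤ n → 1 ≤ k → k ≤ n →
  Σ< F n (λ i → ι F (p i) * uhat F f w u (n ∸ i) k)
    ≈ ([_]⇒_ F (does (k ∣? n)) (D F f w (n div k))
       + [_]⇒_ F (n ≡ᵇ k) (fhat F f w 1 ⁻¹))
proposition4p8 F _ f w w≉0 w-nonroot f1≉0 u right-inverse n k@(suc k′) 1≤n 1≤k _ = begin
  X n                                           ≈⟨ ⋆-injective f̂ X (dilate k G) a≉0 same-convolution n 1≤n ⟩
  dilate k G n                                  ≈⟨ [·]-+ (does (k ∣? n)) _ _ ⟩
  [ does (k ∣? n) ]· D F f w (n div k) + dilate k (λ e → [ e ≡ᵇ 1 ]· b) n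
                                                ≈⟨ +-congˡ (dilate-δ k′ b n) ⟩
  [ does (k ∣? n) ]· D F f w (n div k) + [ n ≡ᵇ k ]· b ∎
  where
  open Field F
  open import Relation.Binary.Reasoning.Setoid setoid
  open FieldLemmas F
  a≉0 : fhat F f w 1 ≉ 0#
  a≉0 = fhat1≉0 f w w≉0 (w-nonroot 0) f1≉0
  open Inverse f w a≉0
  open Column f w w-nonroot u k (λ m 1≤m → right-inverse m k 1≤m 1≤k)
  same-convolution : ∀ m → 1 ≤ m → (f̂ ⋆ X) m ≈ (f̂ ⋆ dilate k G) m
  same-convolution m 1≤m = begin
    (f̂ ⋆ X) m                ≈⟨ f̂⋆X m 1≤m ⟩
    δ k m                    ≈⟨ sym (dilate-δ k′ 1# m) ⟩
    dilate k (δ 1) m         ≈⟨ sym (dilate-cong k′ (f̂ ⋆ G) (δ 1) m 1≤m inverse) ⟩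
    dilate k (f̂ ⋆ G) m       ≈⟨ sym (⋆-dilate f̂ G k′ m 1≤m) ⟩
    (f̂ ⋆ dilate k G) m       ∎
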